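{- Let $\mathcal{F}$ be a finite union-closed family of sets with $\emptyset\notin\mathcal{F}$. If the height number satisfies $H(\mathcal{F})\le3$, then there exists an element $x$ which belongs to more than half of the sets of $\mathcal{F}$.
   Context: A union-closed family is a finite family $\mathcal{F}$ of finite sets closed under pairwise union. Height decomposition: $\pi_1$ is the set of inclusion-minimal members of $\mathcal{F}$; inductively, while $\mathcal{F}\setminus(\pi_1\cup\dots\cup\pi_{i-1})\neq\emptyset$, $\pi_i$ is the set of inclusion-minimal members of $\mathcal{F}\setminus(\pi_1\cup\dots\cup\pi_{i-1})$; the number of steps until $\mathcal{F}$ is exhausted is the height number $H(\mathcal{F})$. -}

module Defs where

open import Data.Nat using (ℕ; zero; suc)
open import Data.Bool using (Bool)
import Data.Bool as Bool
open import Data.Product using (_×_)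
open import Data.List using (List; []; _∷_; filter; length)
open import Data.List.Relation.Unary.Any using (any?)
open import Data.Fin.Subset using (Subset; _⊆_)
open import Data.Fin.Subset.Properties using (_⊆?_)
open import Data.Vec.Properties using (≡-dec)
open import Relation.Binary.PropositionalEquality using (_≡_; _≢_)
open import Relation.Nullary using (Dec; ¬?)
open import Relation.Nullary.Decidable using (_×-dec_)

_⊊_ : ∀ {n} → Subset n → Subset n → Set
B ⊊ A = B ⊆ A × B ≢ A

_⊊?_ : ∀ {n} (B A : Subset n) → Dec (B ⊊ A)
B ⊊? A = (B ⊆? A) ×-dec ¬? (≡-dec Bool._≟_ B A)

minimals : ∀ {n} → List (Subset n) → List (Subset n)
minimals G = filter (λ A → ¬? (any? (λ B → B ⊊? A) G)) G

nonMinimals : ∀ {n} → List (Subset n) → List (Subset n)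
nonMinimals G = filter (λ A → any? (λ B → B ⊊? A) G) G

-- number of layers π₁, π₂, … peeled off (fuel bounds the number of steps)
heightWithFuel : ∀ {n} → ℕ → List (Subset n) → ℕ
heightWithFuel _       []      = 0
heightWithFuel zero    (_ ∷ _) = 0
heightWithFuel (suc k) G@(_ ∷ _) = suc (heightWithFuel k (nonMinimals G))

-- height number H(F); each step removes ≥ 1 set, so length F fuel suffices
height : ∀ {n} → List (Subset n) → ℕ
height G = heightWithFuel (length G) G

-- Let U be the top of F (the union of its members) and, for x ∈ U, let M x be the union of the
-- members avoiding x. As F has no chain of four members, a member strictly between M x and U
-- would leave M x as the only member avoiding x while two members contain x; so M x is a
-- coatom whenever x is rare. Distinct coatoms are incomparable, hence for rare x and y,
-- y ∈ M x forces x ∈ M y.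
-- Take rare x and a rare y ∈ M x. The members avoiding both lie strictly below M x, so there
-- is at most one, while inclusion–exclusion and the rarity of x and y make them at least as
-- many as the members containing both, U among them. So some A ∈ F avoids x and y, and U is
-- the only member containing both. Then every z ∈ A is abundant: otherwise M z would be a
-- coatom containing x and y, since z ∈ M x ∩ M y.
module Submission where

open import Defs
open import Data.Bool using (true; false) renaming (_≟_ to _≟ᵇ_)
open import Data.Fin using (Fin)
open import Data.Fin.Subset using (Subset; _⊆_; _∪_; ⊥; ⋃; Nonempty) renaming (_∈_ to _∈ₛ_; _∉_ to _∉ₛ_)
open import Data.Fin.Subset.Properties
  using (_∈?_; ⊆-antisym; ⊆-trans; p⊆p∪q; q⊆p∪q; x∈p∪q⁻; ∪-identityʳ; ∉⊥; nonempty?; Empty-unique)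
open import Data.List using (List; []; _∷_; filter; length)
open import Data.List.Membership.Propositional using (_∈_; _∉_; lose)
open import Data.List.Membership.Propositional.Properties using (∈-filter⁺; ∈-filter⁻; ∈-length)
open import Data.List.Properties using (filter-notAll)
open import Data.List.Relation.Unary.All using (All; []; _∷_; tabulate)
open import Data.List.Relation.Unary.AllPairs using (_∷_)
open import Data.List.Relation.Unary.Any using (here; there; any?)
open import Data.List.Relation.Unary.Unique.Propositional using (Unique)
import Data.List.Relation.Unary.Unique.Propositional.Properties as Unique
open import Data.Nat using (ℕ; suc; _+_; _*_; _<_; _≤_; _<?_; z≤n; s≤s)
open import Data.Nat.Properties
  using (+-suc; +-identityʳ; *-distribˡ-+; +-mono-≤; +-monoˡ-≤; +-monoʳ-<; +-cancelˡ-≤; *-cancelˡ-≤;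
         ≤-trans; ≤-<-trans; m≤n⇒m≤1+n; <⇒≱; ≮⇒≥; module ≤-Reasoning)
open import Data.Product using (_×_; _,_; proj₁; proj₂; ∃)
open import Data.Sum using (_⊎_; inj₁; inj₂)
open import Data.Vec.Properties using (≡-dec)
open import Function using (id; _∘_)
open import Relation.Binary.PropositionalEquality using (_≡_; _≢_; refl; sym; trans; cong; subst)
open import Relation.Nullary using (Dec; yes; no; ¬_; ¬?; does; contradiction)
open import Relation.Nullary.Decidable using (_×-dec_; decidable-stable)
open import Relation.Unary using (Pred; Decidable)
open import Relation.Unary.Properties using (∁?)

module _ {a} {A : Set a} where

  0<length⇒∃∈ : ∀ {xs : List A} → 0 < length xs → ∃ (_∈ xs)
  0<length⇒∃∈ {x ∷ _} _ = x , here refl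

  length≤1 : ∀ {xs : List A} → Unique xs → (∀ {x y} → x ∈ xs → y ∈ xs → x ≡ y) → length xs ≤ 1
  length≤1 {[]}        _               _    = z≤n
  length≤1 {_ ∷ []}    _               _    = s≤s z≤n
  length≤1 {_ ∷ _ ∷ _} ((x≢y ∷ _) ∷ _) all≡ = contradiction (all≡ (here refl) (there (here refl))) x≢y

  2≤length : ∀ {xs : List A} {x y} → x ∈ xs → y ∈ xs → x ≢ y → 2 ≤ length xs
  2≤length (here refl)  (here refl)  x≢y = contradiction refl x≢y
  2≤length (here refl)  (there y∈xs) _   = s≤s (∈-length y∈xs)
  2≤length (there x∈xs) (here refl)  _   = s≤s (∈-length x∈xs)
  2≤length (there x∈xs) (there y∈xs) x≢y = m≤n⇒m≤1+n (2≤length x∈xs y∈xs x≢y)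

module _ {a ℓ} {A : Set a} {P : Pred A ℓ} (P? : Decidable P) where

  length-filter+length-filter-∁ : ∀ xs → length (filter P? xs) + length (filter (∁? P?) xs) ≡ length xs
  length-filter+length-filter-∁ []       = refl
  length-filter+length-filter-∁ (x ∷ xs) with does (P? x)
  ... | true  = cong suc (length-filter+length-filter-∁ xs)
  ... | false = trans (+-suc _ _) (cong suc (length-filter+length-filter-∁ xs))

module _ {a ℓ₁ ℓ₂} {A : Set a} {P : Pred A ℓ₁} {Q : Pred A ℓ₂} (P? : Decidable P) (Q? : Decidable Q) where

  both? : Decidable (λ x → P x × Q x)
  both? x = P? x ×-dec Q? x

  neither? : Decidable (λ x → ¬ P x × ¬ Q x)
  neither? x = ¬? (P? x) ×-dec ¬? (Q? x)

  private
    #P #Q #both #neither : List A → ℕ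
    #P       = length ∘ filter P?
    #Q       = length ∘ filter Q?
    #both    = length ∘ filter both?
    #neither = length ∘ filter neither?

  inclusion-exclusion : ∀ xs → length (filter P? xs) + length (filter Q? xs) + length (filter neither? xs)
                             ≡ length xs + length (filter both? xs)
  inclusion-exclusion []       = refl
  inclusion-exclusion (x ∷ xs) with does (P? x) | does (Q? x) | inclusion-exclusion xs
  ... | true  | true  | ih = cong suc (trans (cong (_+ #neither xs) (+-suc (#P xs) (#Q xs)))
                                      (trans (cong suc ih) (sym (+-suc (length xs) (#both xs)))))
  ... | true  | false | ih = cong suc ih
  ... | false | true  | ih = trans (cong (_+ #neither xs) (+-suc (#P xs) (#Q xs))) (cong suc ih)
  ... | false | false | ih = trans (+-suc (#P xs + #Q xs) (#neither xs)) (cong suc ih)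

  both≤neither : ∀ xs → 2 * length (filter P? xs) ≤ length xs → 2 * length (filter Q? xs) ≤ length xs
               → length (filter both? xs) ≤ length (filter neither? xs)
  both≤neither xs 2p≤n 2q≤n = +-cancelˡ-≤ (length xs) _ _ (begin
    length xs + #both xs    ≡⟨ inclusion-exclusion xs ⟨
    #P xs + #Q xs + #neither xs ≤⟨ +-monoˡ-≤ (#neither xs) p+q≤n ⟩
    length xs + #neither xs ∎)
    where
    open ≤-Reasoning
    p+q≤n : #P xs + #Q xs ≤ length xs
    p+q≤n = *-cancelˡ-≤ 2 (begin
      2 * (#P xs + #Q xs)     ≡⟨ *-distribˡ-+ 2 (#P xs) (#Q xs) ⟩
      2 * #P xs + 2 * #Q xs   ≤⟨ +-mono-≤ 2p≤n 2q≤n ⟩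
      length xs + length xs   ≡⟨ cong (length xs +_) (+-identityʳ (length xs)) ⟨
      2 * length xs           ∎)

module _ {n : ℕ} where

  infix 4 _≟_
  _≟_ : (A B : Subset n) → Dec (A ≡ B)
  _≟_ = ≡-dec _≟ᵇ_

  ⊊-trans : ∀ {A B C : Subset n} → A ⊊ B → B ⊊ C → A ⊊ C
  ⊊-trans (A⊆B , A≢B) (B⊆C , _) = ⊆-trans A⊆B B⊆C , λ { refl → A≢B (⊆-antisym A⊆B B⊆C) }

  ⊆-⊊-trans : ∀ {A B C : Subset n} → A ⊆ B → B ⊊ C → A ⊊ C
  ⊆-⊊-trans A⊆B (B⊆C , B≢C) = ⊆-trans A⊆B B⊆C , λ { refl → B≢C (⊆-antisym B⊆C A⊆B) }

  ⊊-∪ : ∀ {A B : Subset n} → A ≢ B → A ⊊ (A ∪ B) ⊎ B ⊊ (A ∪ B)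
  ⊊-∪ {A} {B} A≢B with A ≟ A ∪ B
  ... | no  A≢A∪B = inj₁ (p⊆p∪q B , A≢A∪B)
  ... | yes A≡A∪B = inj₂ (q⊆p∪q A B , λ B≡A∪B → A≢B (trans A≡A∪B (sym B≡A∪B)))

  x∉∪ : ∀ {x : Fin n} {A B} → x ∉ₛ A → x ∉ₛ B → x ∉ₛ A ∪ B
  x∉∪ {A = A} {B} x∉A x∉B x∈A∪B with x∈p∪q⁻ A B x∈A∪B
  ... | inj₁ x∈A = x∉A x∈A
  ... | inj₂ x∈B = x∉B x∈B

  ⊆-⋃ : ∀ {A} {As : List (Subset n)} → A ∈ As → A ⊆ ⋃ As
  ⊆-⋃ {As = B ∷ Bs} (here refl)  = p⊆p∪q (⋃ Bs)
  ⊆-⋃ {As = B ∷ Bs} (there A∈Bs) = ⊆-trans (⊆-⋃ A∈Bs) (q⊆p∪q B (⋃ Bs))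

  x∉⋃ : ∀ {x : Fin n} {As} → All (x ∉ₛ_) As → x ∉ₛ ⋃ As
  x∉⋃ []           = ∉⊥
  x∉⋃ (x∉A ∷ x∉As) = x∉∪ x∉A (x∉⋃ x∉As)

  ⋃-∈ : ∀ {F : List (Subset n)} → (∀ {A B} → A ∈ F → B ∈ F → (A ∪ B) ∈ F)
      → ∀ {A As} → A ∈ As → All (_∈ F) As → ⋃ As ∈ F
  ⋃-∈ {F} _      {As = B ∷ []}    _ (B∈F ∷ [])    = subst (_∈ F) (sym (∪-identityʳ B)) B∈F
  ⋃-∈     closed {As = _ ∷ _ ∷ _} _ (B∈F ∷ As∈F) = closed B∈F (⋃-∈ closed (here refl) As∈F)

  infixr 5 _∷⟨_⟩_

  data StrictChain (G : List (Subset n)) : ℕ → Subset n → Set where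
    [_]    : ∀ {A} → A ∈ G → StrictChain G 1 A
    _∷⟨_⟩_ : ∀ {A B k} → A ∈ G → A ⊊ B → StrictChain G k B → StrictChain G (suc k) A

  chain-filter⁺ : ∀ {ℓ} {P : Pred (Subset n) ℓ} (P? : Decidable P) {G k A}
                → (∀ {B C} → B ∈ G → P B → B ⊊ C → P C)
                → P A → StrictChain G k A → StrictChain (filter P? G) k A
  chain-filter⁺ P? up pA [ A∈G ]                = [ ∈-filter⁺ P? A∈G pA ]
  chain-filter⁺ P? up pA (A∈G ∷⟨ A⊊B ⟩ chain) =
    ∈-filter⁺ P? A∈G pA ∷⟨ A⊊B ⟩ chain-filter⁺ P? up (up A∈G pA A⊊B) chain

  chain⇒≤length : ∀ {G k A} → StrictChain G k A → k ≤ length G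
  chain⇒≤length [ A∈G ] = ∈-length A∈G
  chain⇒≤length {G} (A∈G ∷⟨ A⊊B ⟩ chain) =
    ≤-<-trans (chain⇒≤length (chain-filter⁺ (_ ⊊?_) (λ _ A⊊B B⊊C → ⊊-trans A⊊B B⊊C) A⊊B chain))
              (filter-notAll (_ ⊊?_) G (lose A∈G λ A⊊A → proj₂ A⊊A refl))

  chain⇒≤heightWithFuel : ∀ {G k A f} → StrictChain G k A → k ≤ f → k ≤ heightWithFuel f G
  chain⇒≤heightWithFuel {[]}    [ () ]                _
  chain⇒≤heightWithFuel {[]}    (() ∷⟨ _ ⟩ _)         _
  chain⇒≤heightWithFuel {_ ∷ _} [ _ ]                 (s≤s _)   = s≤s z≤n
  chain⇒≤heightWithFuel {G@(_ ∷ _)} (A∈G ∷⟨ A⊊B ⟩ chain) (s≤s k≤f) =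
    s≤s (chain⇒≤heightWithFuel (chain-filter⁺ (λ C → any? (_⊊? C) G) (λ B∈G _ B⊊C → lose B∈G B⊊C)
                                              (lose A∈G A⊊B) chain) k≤f)

  chain⇒≤height : ∀ {G k A} → StrictChain G k A → k ≤ height G
  chain⇒≤height chain = chain⇒≤heightWithFuel chain (chain⇒≤length chain)

module HeightAtMostThree {n} {F : List (Subset n)} (F-unique : Unique F)
  (closed : ∀ {A B} → A ∈ F → B ∈ F → (A ∪ B) ∈ F) (∅∉F : ⊥ ∉ F) (height≤3 : height F ≤ 3)
  {A₀} (A₀∈F : A₀ ∈ F) where

  U : Subset n
  U = ⋃ F

  U∈F : U ∈ F
  U∈F = ⋃-∈ closed A₀∈F (tabulate id)

  ⊆U : ∀ {A} → A ∈ F → A ⊆ U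
  ⊆U = ⊆-⋃

  nonempty : ∀ {A} → A ∈ F → Nonempty A
  nonempty {A} A∈F = decidable-stable (nonempty? A) λ empty → ∅∉F (subst (_∈ F) (Empty-unique empty) A∈F)

  chain₃⇒top≡U : ∀ {A B C} → A ⊊ B → B ⊊ C → A ∈ F → B ∈ F → C ∈ F → C ≡ U
  chain₃⇒top≡U A⊊B B⊊C A∈F B∈F C∈F = decidable-stable (_ ≟ U) λ C≢U →
    <⇒≱ (s≤s height≤3) (chain⇒≤height (A∈F ∷⟨ A⊊B ⟩ B∈F ∷⟨ B⊊C ⟩ C∈F ∷⟨ ⊆U C∈F , C≢U ⟩ [ U∈F ]))

  length-filter≤1 : ∀ {ℓ} {P : Pred (Subset n) ℓ} (P? : Decidable P) → (∀ {A B} → P A → P B → P (A ∪ B))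
                  → ∀ {T} → T ∈ F → T ≢ U → (∀ {A} → A ∈ F → P A → A ⊊ T) → length (filter P? F) ≤ 1
  length-filter≤1 P? ∪-closed {T} T∈F T≢U below = length≤1 (Unique.filter⁺ P? F-unique) equal
    where
    equal : ∀ {A B} → A ∈ filter P? F → B ∈ filter P? F → A ≡ B
    equal {A} {B} A∈ B∈ with ∈-filter⁻ P? A∈ | ∈-filter⁻ P? B∈
    ... | A∈F , pA | B∈F , pB = decidable-stable (A ≟ B) λ A≢B → T≢U (T≡U (⊊-∪ A≢B))
      where
      A∪B∈F = closed A∈F B∈F
      A∪B⊊T = below A∪B∈F (∪-closed pA pB)
      T≡U : A ⊊ (A ∪ B) ⊎ B ⊊ (A ∪ B) → T ≡ U
      T≡U (inj₁ A⊊A∪B) = chain₃⇒top≡U A⊊A∪B A∪B⊊T A∈F A∪B∈F T∈F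
      T≡U (inj₂ B⊊A∪B) = chain₃⇒top≡U B⊊A∪B A∪B⊊T B∈F A∪B∈F T∈F

  Containing Avoiding : Fin n → List (Subset n)
  Containing x = filter (x ∈?_) F
  Avoiding   x = filter (∁? (x ∈?_)) F

  Abundant : Fin n → Set
  Abundant x = length F < 2 * length (Containing x)

  abundant? : ∀ x → Dec (Abundant x)
  abundant? x = length F <? 2 * length (Containing x)

  avoiding<containing⇒abundant : ∀ x → length (Avoiding x) < length (Containing x) → Abundant x
  avoiding<containing⇒abundant x avoiding<containing = begin-strict
    length F                 ≡⟨ length-filter+length-filter-∁ (x ∈?_) F ⟨
    #C + length (Avoiding x) <⟨ +-monoʳ-< #C avoiding<containing ⟩
    #C + #C                  ≡⟨ cong (#C +_) (+-identityʳ #C) ⟨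
    2 * #C                   ∎
    where
    open ≤-Reasoning
    #C = length (Containing x)

  -- ⋃ [] = ⊥, so maxAvoiding x is a member of F only when some member avoids x.
  maxAvoiding : Fin n → Subset n
  maxAvoiding x = ⋃ (Avoiding x)

  ⊆maxAvoiding : ∀ {x A} → A ∈ F → x ∉ₛ A → A ⊆ maxAvoiding x
  ⊆maxAvoiding A∈F x∉A = ⊆-⋃ (∈-filter⁺ _ A∈F x∉A)

  ∉maxAvoiding : ∀ x → x ∉ₛ maxAvoiding x
  ∉maxAvoiding x = x∉⋃ {As = Avoiding x} (tabulate λ A∈ → proj₂ (∈-filter⁻ (∁? (x ∈?_)) {xs = F} A∈))

  record Coatom (T : Subset n) : Set where
    field
      member  : T ∈ F
      proper  : T ≢ U
      maximal : ∀ {Y} → Y ∈ F → T ⊊ Y → Y ≡ U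

  open Coatom

  coatom-⊆⇒≡ : ∀ {T T'} → Coatom T → Coatom T' → T ⊆ T' → T ≡ T'
  coatom-⊆⇒≡ {T} {T'} coT coT' T⊆T' =
    decidable-stable (T ≟ T') λ T≢T' → proper coT' (maximal coT (member coT') (T⊆T' , T≢T'))

  rare⇒coatom : ∀ {x} → x ∈ₛ U → ¬ Abundant x → Coatom (maxAvoiding x)
  rare⇒coatom {x} x∈U rare = record
    { member  = ⋃-∈ closed (proj₂ (0<length⇒∃∈ 0<avoiding))
                    (tabulate λ A∈ → proj₁ (∈-filter⁻ (∁? (x ∈?_)) {xs = F} A∈))
    ; proper  = λ M≡U → ∉maxAvoiding x (subst (x ∈ₛ_) (sym M≡U) x∈U)
    ; maximal = maximal′
    }
    where
    U∈Containing : U ∈ Containing x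
    U∈Containing = ∈-filter⁺ (x ∈?_) U∈F x∈U

    0<avoiding : 0 < length (Avoiding x)
    0<avoiding = ≤-trans (∈-length U∈Containing) (≮⇒≥ (rare ∘ avoiding<containing⇒abundant x))

    maximal′ : ∀ {Y} → Y ∈ F → maxAvoiding x ⊊ Y → Y ≡ U
    maximal′ {Y} Y∈F M⊊Y@(M⊆Y , M≢Y) = decidable-stable (Y ≟ U) λ Y≢U →
      rare (avoiding<containing⇒abundant x (≤-trans (s≤s (avoiding≤1 Y≢U))
                                (2≤length (∈-filter⁺ (x ∈?_) Y∈F x∈Y) U∈Containing Y≢U)))
      where
      x∈Y : x ∈ₛ Y
      x∈Y = decidable-stable (x ∈? Y) λ x∉Y → M≢Y (⊆-antisym M⊆Y (⊆maxAvoiding Y∈F x∉Y))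

      avoiding≤1 : Y ≢ U → length (Avoiding x) ≤ 1
      avoiding≤1 Y≢U = length-filter≤1 (∁? (x ∈?_)) x∉∪ Y∈F Y≢U
                         λ A∈F x∉A → ⊆-⊊-trans (⊆maxAvoiding A∈F x∉A) M⊊Y

  ∈maxAvoiding-sym : ∀ {x y} → x ∈ₛ U → y ∈ₛ U → ¬ Abundant x → ¬ Abundant y
                   → y ∈ₛ maxAvoiding x → x ∈ₛ maxAvoiding y
  ∈maxAvoiding-sym {x} {y} x∈U y∈U rare-x rare-y y∈Mx = decidable-stable (x ∈? maxAvoiding y) λ x∉My →
    ∉maxAvoiding y (subst (y ∈ₛ_) (sym (coatom-⊆⇒≡ coMy coMx (⊆maxAvoiding (member coMy) x∉My))) y∈Mx)
    where
    coMx = rare⇒coatom x∈U rare-x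
    coMy = rare⇒coatom y∈U rare-y

  module RarePair {x y} (x∈U : x ∈ₛ U) (rare-x : ¬ Abundant x) (rare-y : ¬ Abundant y)
                  (y∈Mx : y ∈ₛ maxAvoiding x) where

    coMx : Coatom (maxAvoiding x)
    coMx = rare⇒coatom x∈U rare-x

    y∈U : y ∈ₛ U
    y∈U = ⊆U (member coMx) y∈Mx

    ContainingBoth AvoidingBoth : List (Subset n)
    ContainingBoth = filter (both? (x ∈?_) (y ∈?_)) F
    AvoidingBoth   = filter (neither? (x ∈?_) (y ∈?_)) F

    U∈ContainingBoth : U ∈ ContainingBoth
    U∈ContainingBoth = ∈-filter⁺ _ U∈F (x∈U , y∈U)

    containingBoth≤avoidingBoth : length ContainingBoth ≤ length AvoidingBoth
    containingBoth≤avoidingBoth = both≤neither (x ∈?_) (y ∈?_) F (≮⇒≥ rare-x) (≮⇒≥ rare-y)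

    containingBoth≤1 : length ContainingBoth ≤ 1
    containingBoth≤1 = ≤-trans containingBoth≤avoidingBoth
      (length-filter≤1 _ (λ (x∉A , y∉A) (x∉B , y∉B) → x∉∪ x∉A x∉B , x∉∪ y∉A y∉B)
                       (member coMx) (proper coMx)
                       λ A∈F (x∉A , y∉A) → ⊆maxAvoiding A∈F x∉A , λ { refl → y∉A y∈Mx })

    avoidedByBoth : ∃ λ A → A ∈ F × x ∉ₛ A × y ∉ₛ A
    avoidedByBoth with 0<length⇒∃∈ (≤-trans (∈-length U∈ContainingBoth) containingBoth≤avoidingBoth)
    ... | A , A∈ = A , ∈-filter⁻ _ {xs = F} A∈

    abundant-in-avoider : ∀ {A z} → A ∈ F → x ∉ₛ A → y ∉ₛ A → z ∈ₛ A → Abundant z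
    abundant-in-avoider {A} {z} A∈F x∉A y∉A z∈A = decidable-stable (abundant? z) λ rare-z →
      <⇒≱ (s≤s containingBoth≤1)
          (2≤length (Mz∈ContainingBoth rare-z) U∈ContainingBoth (proper (rare⇒coatom z∈U rare-z)))
      where
      z∈U = ⊆U A∈F z∈A

      Mz∈ContainingBoth : ¬ Abundant z → maxAvoiding z ∈ ContainingBoth
      Mz∈ContainingBoth rare-z =
        ∈-filter⁺ _ (member (rare⇒coatom z∈U rare-z)) (∈Mz x∈U rare-x x∉A , ∈Mz y∈U rare-y y∉A)
        where
        ∈Mz : ∀ {w} → w ∈ₛ U → ¬ Abundant w → w ∉ₛ A → w ∈ₛ maxAvoiding z
        ∈Mz w∈U rare-w w∉A = ∈maxAvoiding-sym w∈U z∈U rare-w rare-z (⊆maxAvoiding A∈F w∉A z∈A)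

  someAbundant : ∃ Abundant
  someAbundant with nonempty U∈F
  ... | x , x∈U with abundant? x
  ... | yes abundant-x = x , abundant-x
  ... | no rare-x with nonempty (member (rare⇒coatom x∈U rare-x))
  ... | y , y∈Mx with abundant? y
  ... | yes abundant-y = y , abundant-y
  ... | no rare-y with RarePair.avoidedByBoth x∈U rare-x rare-y y∈Mx
  ... | A , A∈F , x∉A , y∉A with nonempty A∈F
  ... | z , z∈A = z , RarePair.abundant-in-avoider x∈U rare-x rare-y y∈Mx A∈F x∉A y∉A z∈A

corollary3p3p1 : (n : ℕ) (F : List (Subset n))
    → Unique F
    → F ≢ []
    → (∀ {A B} → A ∈ F → B ∈ F → (A ∪ B) ∈ F)
    → ⊥ ∉ F
    → height F ≤ 3
    → ∃ λ (x : Fin n) → length F < 2 * length (filter (x ∈?_) F)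
corollary3p3p1 n []      _      F≢[] _      _   _        = contradiction refl F≢[]
corollary3p3p1 n (A ∷ F) unique _    closed ∅∉F height≤3 =
  HeightAtMostThree.someAbundant unique closed ∅∉F height≤3 (here refl)
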